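{- Let $G$ be a cubic finite simple graph and let $h$ be a good half-edge coloring of $G$. Then there exists an orientation of $G^{\frac{1}{2}}$ such that for every edge $uv\in E(G)$, if $u'\in N_G(u)\setminus\{v\}$ and $v'\in N_G(v)\setminus\{u\}$ satisfy $h(e_{uu'})=h(e_{vv'})$, then one of the half-edges $e_{uu'}$, $e_{vv'}$ is oriented inwards and the other one is oriented outwards.
   Context: For a graph $G$, $G^{\frac{1}{2}}$ is obtained by subdividing each edge once; the vertices of $G$ are called branch vertices. Each edge $uv$ of $G$ corresponds to two edges of $G^{\frac{1}{2}}$, called half-edges: $e_{uv}$ (joining $u$ to the subdivision vertex of $uv$) and $e_{vu}$. For cubic $G$, a half-edge coloring is a proper edge coloring $h:E(G^{\frac{1}{2}})\to\{1,2,3\}$. A cycle of $G$ is bad if the half-edges of its edges use only two colors; $h$ is good if there is no bad cycle. In an orientation of $G^{\frac{1}{2}}$, a half-edge $e_{uv}$ is oriented inwards if its head is a branch vertex (i.e. $u$), and outwards otherwise. -}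

module Defs where

open import Data.Nat using (ℕ; zero; suc; _+_; _<?_)
open import Data.Fin using (Fin; zero; suc; toℕ; fromℕ<)
open import Data.Bool using (Bool; true; false; T; if_then_else_)
open import Data.List using (List; map; allFin)
open import Data.Nat.ListAction using (sum)
open import Data.Product using (Σ; _×_; _,_; ∃)
open import Data.Sum using (_⊎_)
open import Relation.Nullary using (¬_; yes; no)
open import Relation.Binary.PropositionalEquality using (_≡_; _≢_)
open import Function.Definitions using (Injective)

record Graph (n : ℕ) : Set where
  field
    adj    : Fin n → Fin n → Bool
    sym    : ∀ u v → adj u v ≡ adj v u
    irrefl : ∀ v → adj v v ≡ false

open Graph public

Adj : ∀ {n} → Graph n → Fin n → Fin n → Set
Adj G u v = T (adj G u v)

degree : ∀ {n} → Graph n → Fin n → ℕ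
degree {n} G v = sum (map (λ w → if adj G v w then 1 else 0) (allFin n))

Cubic : ∀ {n} → Graph n → Set
Cubic G = ∀ v → degree G v ≡ 3

-- A half-edge coloring: h u v is the colour (in Fin 3 = {1,2,3}) of the
-- half-edge e_{uv}; only values on adjacent pairs u,v are relevant.
HalfColoring : ℕ → Set
HalfColoring n = Fin n → Fin n → Fin 3

-- proper edge colouring of G^{1/2}:
--  * at a branch vertex u, the half-edges e_{uv}, e_{uw} (v ≠ w) differ;
--  * at the subdivision vertex of uv, e_{uv} and e_{vu} differ.
Proper : ∀ {n} → Graph n → HalfColoring n → Set
Proper G h =
  (∀ u v w → Adj G u v → Adj G u w → v ≢ w → h u v ≢ h u w) ×
  (∀ u v → Adj G u v → h u v ≢ h v u)

next : ∀ {m} → Fin (suc m) → Fin (suc m)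
next {m} i with toℕ i <? m
... | yes p = suc (fromℕ< p)
... | no _  = zero

record Cycle {n} (G : Graph n) : Set where
  field
    len   : ℕ
    vtx   : Fin (suc (suc (suc len))) → Fin n
    inj   : Injective _≡_ _≡_ vtx
    edges : ∀ i → Adj G (vtx i) (vtx (next i))

open Cycle public

Bad : ∀ {n} {G : Graph n} → HalfColoring n → Cycle G → Set
Bad h C = Σ (Fin 3) λ a → Σ (Fin 3) λ b → ∀ i →
  (h (vtx C i) (vtx C (next i)) ≡ a ⊎ h (vtx C i) (vtx C (next i)) ≡ b) ×
  (h (vtx C (next i)) (vtx C i) ≡ a ⊎ h (vtx C (next i)) (vtx C i) ≡ b)

Good : ∀ {n} → Graph n → HalfColoring n → Set
Good G h = Proper G h × (∀ (C : Cycle G) → ¬ Bad h C)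

-- Orientation of G^{1/2}: each half-edge e_{uv} is oriented inwards
-- (head is the branch vertex u) or outwards (head is the subdivision vertex).
data Dir : Set where
  inwards outwards : Dir

Orientation : ℕ → Set
Orientation n = Fin n → Fin n → Dir

module Submission where

-- For a colour c, let F_c be the graph of those edges
-- uv of G whose two half-edges e_uv, e_vu both avoid colour c.  A cycle in
-- F_c would use only the two colours different from c, i.e. be bad; since h
-- is good, F_c is a forest and hence admits a proper 2-colouring p_c.
-- Orient e_uu' inwards iff p_{h(e_uu')}(u) is true.  If uv is an edge and
-- h(e_uu') = h(e_vv') = c with u' ≠ v, v' ≠ u, then properness of h at the
-- branch vertices u and v shows that uv lies in F_c, so p_c(u) ≠ p_c(v) and
-- the two half-edges get opposite orientations.

open import Defs hiding (sym)
open import Data.Nat using (ℕ; zero; suc; _+_; _<_; _≤_; _<?_)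
import Data.Nat.Properties as ℕ
open import Data.Nat.Induction using (<-rec)
open import Data.Fin using (Fin; zero; suc; toℕ; punchIn; punchOut)
import Data.Fin.Properties as Fin
open import Data.Bool using (Bool; true; false; not; T; T?)
open import Data.Bool.Properties using (not-¬)
open import Data.List using (List; []; _∷_; length; filter; allFin)
open import Data.List.Properties using (filter-notAll; length-tabulate)
open import Data.List.Relation.Unary.Any using (here; there)
import Data.List.Relation.Unary.Any as Any
open import Data.List.Membership.Propositional using (_∈_)
open import Data.List.Membership.Propositional.Properties using (∈-filter⁺; ∈-allFin)
open import Data.Product using (Σ; _×_; _,_; ∃; ∃₂; proj₁; proj₂)
open import Data.Sum using (_⊎_; inj₁; inj₂)
open import Data.Empty using (⊥; ⊥-elim)
open import Function using (_∘_)
open import Function.Definitions using (Injective)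
open import Relation.Binary using (tri<; tri≈; tri>)
open import Relation.Nullary using (¬_; Dec; yes; no; ¬?)
open import Relation.Nullary.Decidable using (_×-dec_; decidable-stable)
open import Relation.Binary.PropositionalEquality
  using (_≡_; _≢_; refl; sym; trans; cong; subst)

Relation : ℕ → Set₁
Relation n = Fin n → Fin n → Set

Acyclic : ∀ {n} → Relation n → Set
Acyclic {n} R = ∀ len (c : Fin (suc (suc (suc len))) → Fin n) →
  Injective _≡_ _≡_ c → (∀ i → R (c i) (c (next i))) → ⊥

acyclic-⊆ : ∀ {n} {R S : Relation n} → (∀ {x y} → S x y → R x y) → Acyclic R → Acyclic S
acyclic-⊆ S⊆R acyclic len c injective closes = acyclic len c injective (S⊆R ∘ closes)

next-cases : ∀ {m} (i : Fin (suc m)) →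
  toℕ (next i) ≡ suc (toℕ i) ⊎ (toℕ i ≡ m × next i ≡ zero)
next-cases {m} i with toℕ i <? m
... | yes i<m = inj₁ (cong suc (Fin.toℕ-fromℕ< i<m))
... | no i≮m  = inj₂ (ℕ.≤-antisym (ℕ.≤-pred (Fin.toℕ<n i)) (ℕ.≮⇒≥ i≮m) , refl)

closed-walk-cycle : ∀ {n} {R : Relation n} (w : ℕ → Fin n) → (∀ k → R (w k) (w (suc k))) →
  ∀ len → w (suc (suc (suc len))) ≡ w 0 →
  (∀ a b → a < b → b < suc (suc (suc len)) → w a ≢ w b) → ¬ Acyclic R
closed-walk-cycle {n} {R} w step len closed distinct acyclic = acyclic len c injective closes
  where
    c : Fin (suc (suc (suc len))) → Fin n
    c i = w (toℕ i)

    injective : Injective _≡_ _≡_ c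
    injective {i} {j} ci≡cj with ℕ.<-cmp (toℕ i) (toℕ j)
    ... | tri< i<j _ _ = ⊥-elim (distinct _ _ i<j (Fin.toℕ<n j) ci≡cj)
    ... | tri≈ _ i≡j _ = Fin.toℕ-injective i≡j
    ... | tri> _ _ j<i = ⊥-elim (distinct _ _ j<i (Fin.toℕ<n i) (sym ci≡cj))

    closes : ∀ i → R (c i) (c (next i))
    closes i with next-cases i
    ... | inj₁ incr = subst (R (c i) ∘ w) (sym incr) (step (toℕ i))
    ... | inj₂ (last , wrap) rewrite wrap =
      subst (R (c i)) (trans (cong (w ∘ suc) last) closed) (step (toℕ i))

gap : ∀ {i j} → i < j → ∃ λ d → suc (d + i) ≡ j
gap {i} i<j with ℕ.m≤n⇒∃[o]m+o≡n i<j
... | d , i+1+d≡j = d , trans (cong suc (ℕ.+-comm d i)) i+1+d≡j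

record Walk {n} (R : Relation n) : Set where
  field
    vertex  : ℕ → Fin n
    step    : ∀ k → R (vertex k) (vertex (suc k))
    no-back : ∀ k → vertex (suc (suc k)) ≢ vertex k

open Walk

-- The tail of a walk from time i on.  Indexing by k + i (rather than i + k)
-- makes all fields hold definitionally.
shift : ∀ {n} {R : Relation n} → Walk R → ℕ → Walk R
shift W i = record
  { vertex  = λ k → vertex W (k + i)
  ; step    = λ k → step W (k + i)
  ; no-back = λ k → no-back W (k + i)
  }

first-return-cycle : ∀ {n} {R : Relation n} → (∀ {x} → ¬ R x x) → (W : Walk R) →
  ∀ d → vertex W (suc d) ≡ vertex W 0 →
  (∀ a b → a < b → b < suc d → vertex W a ≢ vertex W b) → ¬ Acyclic R
first-return-cycle {R = R} irrefl W zero closed _ _ =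
  irrefl (subst (R (vertex W 0)) closed (step W 0))
first-return-cycle irrefl W (suc zero) closed _ _ = no-back W 0 closed
first-return-cycle {R = R} irrefl W (suc (suc len)) =
  closed-walk-cycle {R = R} (vertex W) (step W) len

-- In an acyclic irreflexive relation a non-backtracking walk never revisits
-- a vertex: by strong induction on j, a first revisit at time j would be a
-- first return of the tail of the walk starting at the earlier visit.
no-repetition : ∀ {n} {R : Relation n} → (∀ {x} → ¬ R x x) → Acyclic R →
  (W : Walk R) → ∀ j i → i < j → vertex W i ≢ vertex W j
no-repetition irrefl acyclic W = <-rec _ revisit
  where
    revisit : ∀ j → (∀ {b} → b < j → ∀ a → a < b → vertex W a ≢ vertex W b) →
      ∀ i → i < j → vertex W i ≢ vertex W j
    revisit j earlier i i<j wi≡wj with gap i<j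
    ... | d , refl = first-return-cycle irrefl (shift W i) d (sym wi≡wj) distinct acyclic
      where
        distinct : ∀ a b → a < b → b < suc d → vertex W (a + i) ≢ vertex W (b + i)
        distinct a b a<b b<d+1 =
          earlier (ℕ.+-monoˡ-< i b<d+1) (a + i) (ℕ.+-monoˡ-< i a<b)

-- A relation in which every edge p → c can be continued by an edge c → d
-- with d ≠ p, and which has an edge at all, is not acyclic: its
-- non-backtracking walk takes n + 1 steps among n vertices and repeats.
continuable-cyclic : ∀ {n} {R : Relation n} → (∀ {x} → ¬ R x x) →
  (∀ {p c} → R p c → ∃ λ d → R c d × d ≢ p) → ∀ {x y} → R x y → ¬ Acyclic R
continuable-cyclic {n} {R} irrefl continue {x} {y} xy acyclic =
  let i , j , i<j , wi≡wj = Fin.pigeonhole (ℕ.n<1+n n) (λ (k : Fin (suc n)) → vertex W (toℕ k))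
  in no-repetition irrefl acyclic W (toℕ j) (toℕ i) i<j wi≡wj
  where
    Edge : Set
    Edge = Σ (Fin n) λ p → Σ (Fin n) λ c → R p c

    advance : Edge → Edge
    advance (p , c , pc) = c , proj₁ (continue pc) , proj₁ (proj₂ (continue pc))

    edge : ℕ → Edge
    edge zero    = x , y , xy
    edge (suc k) = advance (edge k)

    W : Walk R
    W = record
      { vertex  = λ k → proj₁ (edge k)
      ; step    = λ k → proj₂ (proj₂ (edge k))
      ; no-back = λ k → proj₂ (proj₂ (continue (proj₂ (proj₂ (edge k)))))
      }

some-or-all : ∀ {A : Set} {P Q : A → Set} → (∀ x → P x ⊎ Q x) →
  ∀ xs → (∃ λ x → x ∈ xs × P x) ⊎ (∀ {x} → x ∈ xs → Q x)
some-or-all P⊎Q [] = inj₂ λ ()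
some-or-all P⊎Q (x ∷ xs) with P⊎Q x | some-or-all P⊎Q xs
... | inj₁ px | _                  = inj₁ (x , here refl , px)
... | inj₂ _  | inj₁ (y , y∈ , py) = inj₁ (y , there y∈ , py)
... | inj₂ qx | inj₂ qxs           = inj₂ λ { (here refl) → qx ; (there x∈) → qxs x∈ }

TwoColouring : ∀ {n} → Relation n → Set
TwoColouring {n} R = Σ (Fin n → Bool) λ p → ∀ {x y} → R x y → p x ≢ p y

Leaf : ∀ {n} → Relation n → Fin n → Set
Leaf R x = ∀ {y z} → R x y → R x z → y ≡ z

Branching : ∀ {n} → Relation n → Fin n → Set
Branching R x = ∃₂ λ y z → R x y × R x z × y ≢ z

leaf-or-branching : ∀ {n} {R : Relation n} → (∀ x y → Dec (R x y)) →
  ∀ x → Leaf R x ⊎ Branching R x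
leaf-or-branching R? x
  with Fin.any? (λ y → Fin.any? λ z → R? x y ×-dec R? x z ×-dec ¬? (y Fin.≟ z))
... | yes (y , z , xy , xz , y≢z) = inj₂ (y , z , xy , xz , y≢z)
... | no none = inj₁ λ {y} {z} xy xz →
  decidable-stable (y Fin.≟ z) λ y≢z → none (y , z , xy , xz , y≢z)

-- The colouring is built on growing vertex lists A,
-- for the relation R restricted to A, by repeatedly removing a leaf.
module ForestColouring {n} {R : Relation n} (R? : ∀ x y → Dec (R x y))
  (R-sym : ∀ {x y} → R x y → R y x) (R-irrefl : ∀ {x} → ¬ R x x)
  (acyclic : Acyclic R) where

  open import Data.List.Membership.DecPropositional (Fin._≟_ {n}) using (_∈?_)

  Inside : List (Fin n) → Relation n
  Inside A x y = x ∈ A × y ∈ A × R x y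

  Inside? : ∀ A x y → Dec (Inside A x y)
  Inside? A x y = x ∈? A ×-dec y ∈? A ×-dec R? x y

  _─_ : List (Fin n) → Fin n → List (Fin n)
  A ─ ℓ = filter (λ x → ¬? (x Fin.≟ ℓ)) A

  ─-shorter : ∀ {ℓ A} → ℓ ∈ A → length (A ─ ℓ) < length A
  ─-shorter {ℓ} {A} ℓ∈A =
    filter-notAll (λ x → ¬? (x Fin.≟ ℓ)) A (Any.map (λ ℓ≡x x≢ℓ → x≢ℓ (sym ℓ≡x)) ℓ∈A)

  -- If every vertex of A is branching inside A, then every edge inside A
  -- continues without backtracking, so a vertex in A gives a cycle of R.
  all-branching-cyclic : ∀ {A x} → x ∈ A → (∀ {y} → y ∈ A → Branching (Inside A) y) → ⊥
  all-branching-cyclic {A} x∈A branching =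
    let y , _ , xy , _ = branching x∈A
    in continuable-cyclic (R-irrefl ∘ proj₂ ∘ proj₂) continue xy
         (acyclic-⊆ {S = Inside A} (proj₂ ∘ proj₂) acyclic)
    where
      continue : ∀ {p c} → Inside A p c → ∃ λ d → Inside A c d × d ≢ p
      continue {p} pc with branching (proj₁ (proj₂ pc))
      ... | y , z , cy , cz , y≢z with y Fin.≟ p
      ...   | yes refl = z , cz , y≢z ∘ sym
      ...   | no y≢p   = y , cy , y≢p

  leaf-colour : ∀ {A ℓ} → Leaf (Inside A) ℓ → (p : Fin n → Bool) →
    Σ Bool λ b → ∀ {y} → Inside A ℓ y → b ≢ p y
  leaf-colour {A} {ℓ} leaf p with Fin.any? (Inside? A ℓ)
  ... | yes (y , ℓy) = not (p y) , λ ℓz → not-¬ (cong p (leaf ℓz ℓy)) ∘ sym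
  ... | no none      = false , λ ℓz _ → none (_ , ℓz)

  extend : ∀ {A ℓ} → Leaf (Inside A) ℓ → TwoColouring (Inside (A ─ ℓ)) →
    TwoColouring (Inside A)
  extend {A} {ℓ} leaf (p , proper) = p′ , proper′
    where
      b : Bool
      b = proj₁ (leaf-colour leaf p)

      fresh : ∀ {y} → Inside A ℓ y → b ≢ p y
      fresh = proj₂ (leaf-colour leaf p)

      p′ : Fin n → Bool
      p′ x with x Fin.≟ ℓ
      ... | yes _ = b
      ... | no _  = p x

      flip : ∀ {x y} → Inside A x y → Inside A y x
      flip (x∈ , y∈ , xy) = y∈ , x∈ , R-sym xy

      proper′ : ∀ {x y} → Inside A x y → p′ x ≢ p′ y
      proper′ {x} {y} xy with x Fin.≟ ℓ | y Fin.≟ ℓ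
      ... | yes refl | yes refl = ⊥-elim (R-irrefl (proj₂ (proj₂ xy)))
      ... | yes refl | no _     = fresh xy
      ... | no _     | yes refl = fresh (flip xy) ∘ sym
      ... | no x≢ℓ   | no y≢ℓ   = let x∈ , y∈ , Rxy = xy in
        proper (∈-filter⁺ _ x∈ x≢ℓ , ∈-filter⁺ _ y∈ y≢ℓ , Rxy)

  -- Colouring every list of length at most k, by induction on k: a nonempty
  -- list has a leaf (otherwise R has a cycle), which is removed.
  colour-list : ∀ k A → length A ≤ k → TwoColouring (Inside A)
  colour-list _ [] _ = (λ _ → false) , λ ()
  colour-list (suc k) A@(_ ∷ _) |A|≤1+k
    with some-or-all (leaf-or-branching (Inside? A)) A
  ... | inj₁ (ℓ , ℓ∈A , leaf) = extend leaf (colour-list k (A ─ ℓ)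
          (ℕ.≤-pred (ℕ.≤-trans (─-shorter ℓ∈A) |A|≤1+k)))
  ... | inj₂ branching = ⊥-elim (all-branching-cyclic (here refl) branching)

  two-colouring : TwoColouring R
  two-colouring =
    let p , proper = colour-list n (allFin n) (ℕ.≤-reflexive (length-tabulate (λ x → x)))
    in p , λ {x} {y} xy → proper (∈-allFin x , ∈-allFin y , xy)

other-colour : ∀ c {x : Fin 3} → x ≢ c → x ≡ punchIn c zero ⊎ x ≡ punchIn c (suc zero)
other-colour c {x} x≢c
  with punchOut {i = c} {j = x} (x≢c ∘ sym) | Fin.punchIn-punchOut {i = c} {j = x} (x≢c ∘ sym)
... | zero     | punched = inj₁ (sym punched)
... | suc zero | punched = inj₂ (sym punched)

direction : Bool → Dir
direction true  = inwards
direction false = outwards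

opposite : ∀ {a b} → a ≢ b →
  (direction a ≡ inwards × direction b ≡ outwards) ⊎
  (direction a ≡ outwards × direction b ≡ inwards)
opposite {true}  {true}  a≢b = ⊥-elim (a≢b refl)
opposite {true}  {false} _   = inj₁ (refl , refl)
opposite {false} {true}  _   = inj₂ (refl , refl)
opposite {false} {false} a≢b = ⊥-elim (a≢b refl)

module _ {n} (G : Graph n) (h : HalfColoring n) where

  Avoiding : Fin 3 → Relation n
  Avoiding c u v = Adj G u v × h u v ≢ c × h v u ≢ c

  Avoiding? : ∀ c u v → Dec (Avoiding c u v)
  Avoiding? c u v = T? (adj G u v) ×-dec ¬? (h u v Fin.≟ c) ×-dec ¬? (h v u Fin.≟ c)

  Avoiding-sym : ∀ {c u v} → Avoiding c u v → Avoiding c v u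
  Avoiding-sym {u = u} {v} (uv , huv≢c , hvu≢c) = subst T (Graph.sym G u v) uv , hvu≢c , huv≢c

  Avoiding-irrefl : ∀ {c u} → ¬ Avoiding c u u
  Avoiding-irrefl {u = u} (uu , _) = subst T (Graph.irrefl G u) uu

  -- A cycle of F_c uses only the two colours other than c, so it is bad;
  -- hence for a good colouring each F_c is a forest.
  Avoiding-acyclic : Good G h → ∀ c → Acyclic (Avoiding c)
  Avoiding-acyclic (_ , no-bad) c len cyc cyc-injective avoids =
    no-bad cycle (punchIn c zero , punchIn c (suc zero) , λ i →
      other-colour c (proj₁ (proj₂ (avoids i))) , other-colour c (proj₂ (proj₂ (avoids i))))
    where
      cycle : Cycle G
      cycle = record { len = len ; vtx = cyc ; inj = cyc-injective ; edges = proj₁ ∘ avoids }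

  forest-colouring : Good G h → ∀ c → TwoColouring (Avoiding c)
  forest-colouring good c = ForestColouring.two-colouring (Avoiding? c)
    Avoiding-sym Avoiding-irrefl (Avoiding-acyclic good c)

  -- If h(e_uu') = h(e_vv') = c for an edge uv with u' ≠ v and v' ≠ u, then by
  -- properness of h at the branch vertices u and v, the edge uv lies in F_c.
  edge-avoids : Proper G h → ∀ {u v u' v'} → Adj G u v → Adj G u u' → u' ≢ v →
    Adj G v v' → v' ≢ u → h u u' ≡ h v v' → Avoiding (h u u') u v
  edge-avoids (at-branch , _) {u} {v} {u'} {v'} uv uu' u'≢v vv' v'≢u same =
    uv ,
    at-branch u v u' uv uu' (u'≢v ∘ sym) ,
    λ hvu≡c → at-branch v u v' (subst T (Graph.sym G u v) uv) vv' (v'≢u ∘ sym) (trans hvu≡c same)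

lemma4p2 : ∀ {n} (G : Graph n) → Cubic G → (h : HalfColoring n) → Good G h →
    Σ (Orientation n) λ o →
      ∀ u v → Adj G u v →
      ∀ u' v' → Adj G u u' → u' ≢ v → Adj G v v' → v' ≢ u →
      h u u' ≡ h v v' →
      (o u u' ≡ inwards × o v v' ≡ outwards) ⊎ (o u u' ≡ outwards × o v v' ≡ inwards)
lemma4p2 {n} G _ h good = orientation , antiparallel
  where
    colour : Fin 3 → Fin n → Bool
    colour c = proj₁ (forest-colouring G h good c)

    orientation : Orientation n
    orientation u u' = direction (colour (h u u') u)

    antiparallel : ∀ u v → Adj G u v →
      ∀ u' v' → Adj G u u' → u' ≢ v → Adj G v v' → v' ≢ u →
      h u u' ≡ h v v' →
      (orientation u u' ≡ inwards × orientation v v' ≡ outwards) ⊎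
      (orientation u u' ≡ outwards × orientation v v' ≡ inwards)
    antiparallel u v uv u' v' uu' u'≢v vv' v'≢u same rewrite sym same =
      opposite (proj₂ (forest-colouring G h good (h u u'))
        (edge-avoids G h (proj₁ good) uv uu' u'≢v vv' v'≢u same))
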